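{- Let $q$ be a prime power, $n\ge1$, and fix a generator $\alpha$ of $\mathbb{F}_{q^n}^\times$. Choose $\mathbf{x}$ uniformly at random from $\mathbb{F}_q^n\setminus\{0\}$ and, independently, an ordered basis $\mathcal{B}$ of $\mathbb{F}_{q^n}$ over $\mathbb{F}_q$ uniformly at random. Let $$D(\mathcal{B},\mathbf{x})=\sum_{j=0}^{n-1} e_{j+1}\,\mathbf{x}^\intercal M_{\alpha,\mathcal{B}}^{\,j},$$ i.e. the $n\times n$ matrix whose rows are $\mathbf{x}^\intercal,\mathbf{x}^\intercal M_{\alpha,\mathcal{B}},\ldots,\mathbf{x}^\intercal M_{\alpha,\mathcal{B}}^{n-1}$. Then $D(\mathcal{B},\mathbf{x})^{ -1}$ is distributed uniformly over all invertible matrices in $GL_n(\mathbb{F}_q)$.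
   Context: $e_j$ denotes the $j$-th standard basis column vector of $\mathbb{F}_q^n$. For an ordered basis $\mathcal{B}$ of $\mathbb{F}_{q^n}$ over $\mathbb{F}_q$, $f_{\mathcal{B}}(\gamma)$ is the coordinate column vector of $\gamma\in\mathbb{F}_{q^n}$ in $\mathcal{B}$, and $M_{\alpha,\mathcal{B}}\in\mathbb{F}_q^{n\times n}$ is the matrix of multiplication by $\alpha$ in that basis: $f_{\mathcal{B}}(\alpha\delta)=M_{\alpha,\mathcal{B}}f_{\mathcal{B}}(\delta)$ for all $\delta$. -}

module Defs where

open import Level using (0ℓ)
open import Data.Nat as ℕ using (ℕ; zero; suc)
open import Data.Bool using (Bool; true; false; _∧_; not; T)
open import Data.Fin using (Fin)
open import Data.Vec using (Vec; []; _∷_; replicate; lookup; tabulate; zipWith; foldr)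
open import Data.Vec.Properties using (≡-dec)
open import Data.List as L using (List; length; filterᵇ; cartesianProduct; concatMap)
open import Data.Bool.ListAction using (all; any)
open import Data.List.Membership.Propositional using (_∈_)
open import Data.List.Relation.Unary.Unique.Propositional using (Unique)
open import Data.Product using (Σ; ∃; _×_; _,_; proj₁; proj₂)
open import Relation.Nullary using (¬_; does)
open import Relation.Binary using (DecidableEquality)
open import Relation.Binary.PropositionalEquality using (_≡_)
import Algebra.Structures as AS

record FiniteField : Set₁ where
  infixl 6 _+_
  infixl 7 _*_
  field
    Carrier  : Set
    _+_ _*_  : Carrier → Carrier → Carrier
    -_       : Carrier → Carrier
    0# 1#    : Carrier
    isCommutativeRing : AS.IsCommutativeRing {A = Carrier} _≡_ _+_ _*_ -_ 0# 1#
    0≢1      : ¬ (0# ≡ 1#)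
    inverse  : ∀ x → ¬ (x ≡ 0#) → ∃ λ y → x * y ≡ 1#
    _≟_      : DecidableEquality Carrier
    elements : List Carrier
    complete : ∀ x → x ∈ elements
    unique   : Unique elements



record FieldHom (F K : FiniteField) : Set where
  private
    module F = FiniteField F
    module K = FiniteField K
  field
    ι      : F.Carrier → K.Carrier
    ι-1    : ι F.1# ≡ K.1#
    ι-+    : ∀ x y → ι (x F.+ y) ≡ ι x K.+ ι y
    ι-*    : ∀ x y → ι (x F.* y) ≡ ι x K.* ι y

module _ (F : FiniteField) where
  open FiniteField F

  _==_ : Carrier → Carrier → Bool
  x == y = does (x ≟ y)

  Matrix : ℕ → Set
  Matrix n = Vec (Vec Carrier n) n    -- list of rows

  allVecsOf : {A : Set} → List A → (n : ℕ) → List (Vec A n)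
  allVecsOf xs zero    = [] L.∷ L.[]
  allVecsOf xs (suc n) = concatMap (λ x → L.map (x ∷_) (allVecsOf xs n)) xs

  allVecs : (n : ℕ) → List (Vec Carrier n)
  allVecs = allVecsOf elements

  allMatrices : (n : ℕ) → List (Matrix n)
  allMatrices n = allVecsOf (allVecs n) n

  vecEq : ∀ {n} → Vec Carrier n → Vec Carrier n → Bool
  vecEq u v = does (≡-dec _≟_ u v)

  matEq : ∀ {n} → Matrix n → Matrix n → Bool
  matEq A B = does (≡-dec (≡-dec _≟_) A B)

  zeroVec : ∀ n → Vec Carrier n
  zeroVec n = replicate n 0#

  dot : ∀ {n} → Vec Carrier n → Vec Carrier n → Carrier
  dot u v = foldr _ _+_ 0# (zipWith _*_ u v)

  column : ∀ {n} → Matrix n → Fin n → Vec Carrier n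
  column A j = Data.Vec.map (λ row → lookup row j) A

  _·_ : ∀ {n} → Matrix n → Matrix n → Matrix n
  A · B = tabulate λ i → tabulate λ j → dot (lookup A i) (column B j)

  identity : ∀ n → Matrix n
  identity n = tabulate λ i → tabulate λ j → does (i Data.Fin.≟ j) |> λ { true → 1# ; false → 0# }
    where
      _|>_ : {A B : Set} → A → (A → B) → B
      x |> f = f x

  _ᵀ·_ : ∀ {n} → Vec Carrier n → Matrix n → Vec Carrier n
  x ᵀ· M = tabulate λ j → dot x (column M j)

  isInverseOf : ∀ {n} → Matrix n → Matrix n → Bool
  isInverseOf {n} B A = matEq (A · B) (identity n) ∧ matEq (B · A) (identity n)

  isInvertible : ∀ {n} → Matrix n → Bool
  isInvertible {n} A = any (λ B → isInverseOf B A) (allMatrices n)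

  GLcount : ℕ → ℕ
  GLcount n = length (filterᵇ isInvertible (allMatrices n))

module Extension (F K : FiniteField) (h : FieldHom F K) where
  private
    module F = FiniteField F
    module K = FiniteField K
  open FieldHom h

  lincomb : ∀ {n} → Vec F.Carrier n → Vec K.Carrier n → K.Carrier
  lincomb c b = foldr _ K._+_ K.0# (zipWith (λ ci bi → ι ci K.* bi) c b)

  coordsOf : ∀ {n} → Vec K.Carrier n → K.Carrier → List (Vec F.Carrier n)
  coordsOf {n} b γ = filterᵇ (λ c → _==_ K (lincomb c b) γ) (allVecs F n)

  isBasis : ∀ {n} → Vec K.Carrier n → Bool
  isBasis b = all (λ γ → does (length (coordsOf b γ) ℕ.≟ 1)) K.elements

  allBases : (n : ℕ) → List (Vec K.Carrier n)
  allBases n = filterᵇ isBasis (allVecs K n)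

  f_ : ∀ {n} → Vec K.Carrier n → K.Carrier → Vec F.Carrier n
  f_ {n} b γ with coordsOf b γ
  ... | L.[]      = zeroVec F n
  ... | c L.∷ _   = c

  -- M_{α,B}: column j is f_B(α · b_j), i.e. f_B(αδ) = M f_B(δ)
  M : ∀ {n} → K.Carrier → Vec K.Carrier n → Matrix F n
  M α b = tabulate λ i → tabulate λ j → lookup (f_ b (α K.* lookup b j)) i

  _^_ : ∀ {n} → Matrix F n → ℕ → Matrix F n
  _^_ {n} A zero    = identity F n
  _^_ {n} A (suc k) = _·_ F (A ^ k) A

  D : ∀ {n} → K.Carrier → Vec K.Carrier n → Vec F.Carrier n → Matrix F n
  D α b x = tabulate λ j → _ᵀ·_ F x (M α b ^ Data.Fin.toℕ j)

  sampleSpace : (n : ℕ) → List (Vec K.Carrier n × Vec F.Carrier n)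
  sampleSpace n = filterᵇ (λ p → isBasis (proj₁ p) ∧ not (vecEq F (proj₂ p) (zeroVec F n)))
                          (cartesianProduct (allVecs K n) (allVecs F n))

  fiberCount : K.Carrier → (n : ℕ) → Matrix F n → ℕ
  fiberCount α n A = length (filterᵇ (λ p → isInverseOf F A (D α (proj₁ p) (proj₂ p))) (sampleSpace n))

  HasDegree : ℕ → Set
  HasDegree n = ∃ λ (b : Vec K.Carrier n) → T (isBasis b)

  IsGenerator : K.Carrier → Set
  IsGenerator α = ∀ γ → ¬ (γ ≡ K.0#) → ∃ λ k → pow k ≡ γ
    where
      pow : ℕ → K.Carrier
      pow zero    = K.1#
      pow (suc k) = pow k K.* α

-- Write ℓ = xᵀ f_B for the F-linear functional K → F whose coordinate vector in the basis B
-- is x. The (j , k) entry of D(B, x) is ℓ(αʲ b_k), so D(B, x) = E exactly when the Krylov map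
-- Φ_ℓ(γ) = (ℓ(αʲ γ))_{j<n} sends each b_k to the k-th column of E.
--
-- For ℓ ≠ 0 the map Φ_ℓ is injective, hence by counting a linear bijection K → Fⁿ. Indeed the
-- n + 1 powers 1, α, …, αⁿ are linearly dependent, so some αᵐ with m ≤ n is a combination of
-- lower powers; if ℓ(αʲ δ) = 0 for all j < n this propagates to every power of α, whereas for
-- δ ≠ 0 some αᵏ δ is a point where ℓ does not vanish, because α generates K^×.
--
-- Therefore (B, x) ↦ ℓ is a bijection from the fibre over E = A⁻¹ onto the nonzero
-- functionals, with inverse b_k = Φ_ℓ⁻¹(E e_k), x = (ℓ(b_k))_k. Every fibre has qⁿ − 1
-- elements, and as ordered bases correspond to invertible matrices, the fibre size times
-- |GL_n(F)| is (qⁿ − 1) times the number of bases, the size of the sample space.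

module Submission where

open import Level using (0ℓ)
open import Algebra.Bundles using (CommutativeRing)
import Algebra.Properties.Ring as RingProperties
import Algebra.Properties.CommutativeSemigroup as CommutativeSemigroupProperties
import Algebra.Properties.Semiring.Sum as SemiringSum
import Algebra.Properties.Semiring.Exp as SemiringExp
open import Defs
open import Data.Nat as Nat using (ℕ; zero; suc; _≤_; _<_; z≤n)
import Data.Nat.Properties as NatP
open import Data.Nat.Induction using (<-rec)
open import Data.Bool using (Bool; true; false; T; _∧_; not)
open import Data.Bool.Properties using (T-∧)
open import Data.Product.Properties using () renaming (≡-dec to ≡-dec-×)
open import Data.Product as Product using (∃; _×_; _,_; proj₁; proj₂)
open import Data.Fin using (Fin; zero; suc; toℕ; fromℕ<; punchIn)
open import Data.Fin.Properties using (punchInᵢ≢i; ¬∀⟶∃¬; toℕ-fromℕ<)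
open import Data.Vec as Vec using (Vec; []; _∷_; lookup; tabulate)
open import Data.Vec.Properties
  using (∷-injective; ≡-dec; lookup-map; lookup-zipWith; lookup-replicate; lookup∘tabulate; tabulate∘lookup; tabulate-cong)
open import Data.List as List
  using (List; []; _∷_; _++_; length; filter; filterᵇ; concatMap; cartesianProduct; cartesianProductWith)
open import Data.List.Properties using (length-++; length-map; filter-++; filter-notAll; filter-none)
open import Data.List.Relation.Unary.Any as Any using (here; there; any?)
open import Data.List.Relation.Unary.All as All using ([]; _∷_)
open import Data.List.Relation.Unary.All.Properties using (all⁺; all⁻)
open import Data.List.Relation.Unary.Any.Properties using (any⁺; any⁻)
open import Data.List.Relation.Unary.AllPairs using ([]; _∷_)
open import Data.List.Membership.Propositional using (_∈_; find; lose)
open import Data.List.Membership.Propositional.Properties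
  using (∈-filter⁺; ∈-filter⁻; ∈-cartesianProductWith⁺; ∈-cartesianProduct⁺)
open import Data.List.Relation.Unary.Unique.Propositional using (Unique)
open import Data.List.Relation.Unary.Unique.Propositional.Properties
  using (filter⁺; cartesianProductWith⁺; cartesianProduct⁺)
open import Data.Empty using (⊥-elim)
open import Function using (_∘_; _⇔_; mk⇔; Equivalence)
open import Relation.Nullary using (¬_; Dec; yes; no; does; ¬?)
open import Relation.Nullary.Decidable using (T?)
open import Relation.Binary using (DecidableEquality)
open import Relation.Binary.PropositionalEquality using (_≡_; _≢_; refl; sym; trans; cong; cong₂; subst; module ≡-Reasoning)

T-does : ∀ {P : Set} (P? : Dec P) → T (does P?) ⇔ P
T-does (yes p) = mk⇔ (λ _ → p) (λ _ → _)
T-does (no ¬p) = mk⇔ (λ ()) ¬p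

T-not-does : ∀ {P : Set} (P? : Dec P) → T (not (does P?)) ⇔ (¬ P)
T-not-does (yes p) = mk⇔ (λ ()) (λ ¬p → ¬p p)
T-not-does (no ¬p) = mk⇔ (λ _ → ¬p) (λ _ → _)

lookup-ext : ∀ {A : Set} {n} {u v : Vec A n} → (∀ i → lookup u i ≡ lookup v i) → u ≡ v
lookup-ext {u = u} {v} u≗v = trans (sym (tabulate∘lookup u)) (trans (tabulate-cong u≗v) (tabulate∘lookup v))

lookup-tabulate² : ∀ {A : Set} {m n} (f : Fin m → Fin n → A) (i : Fin m) (j : Fin n) →
                   lookup (lookup (tabulate λ i → tabulate (f i)) i) j ≡ f i j
lookup-tabulate² f i j = trans (cong (λ row → lookup row j) (lookup∘tabulate _ i)) (lookup∘tabulate (f i) j)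

module ListCounting where
  open Nat using (_+_; _*_)

  private
    variable
      A B : Set

  ∈-filterᵇ⁺ : (p : A → Bool) {xs : List A} {x : A} → x ∈ xs → T (p x) → x ∈ filterᵇ p xs
  ∈-filterᵇ⁺ p = ∈-filter⁺ (T? ∘ p)

  ∈-filterᵇ⁻ : (p : A → Bool) (xs : List A) {x : A} → x ∈ filterᵇ p xs → x ∈ xs × T (p x)
  ∈-filterᵇ⁻ p xs = ∈-filter⁻ (T? ∘ p) {xs = xs}

  filterᵇ-unique : {p : A → Bool} {xs : List A} → Unique xs → Unique (filterᵇ p xs)
  filterᵇ-unique {p = p} = filter⁺ (T? ∘ p)

  InjectiveOn : (A → B) → List A → Set
  InjectiveOn f xs = ∀ {x y} → x ∈ xs → y ∈ xs → f x ≡ f y → x ≡ y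

  length-≤-injection : DecidableEquality B → (f : A → B) {xs : List A} {ys : List B} → Unique xs →
                       (∀ {x} → x ∈ xs → f x ∈ ys) → InjectiveOn f xs → length xs ≤ length ys
  length-≤-injection _≟_ f {[]} _ _ _ = z≤n
  length-≤-injection _≟_ f {x ∷ xs} {ys} (x∉xs ∷ xs!) into inj =
    NatP.≤-<-trans (length-≤-injection _≟_ f xs! into′ (λ p q → inj (there p) (there q)))
                   (filter-notAll (λ y → ¬? (f x ≟ y)) ys (Any.map (λ fx≡y fx≢y → fx≢y fx≡y) (into (here refl))))
    where
      into′ : ∀ {y} → y ∈ xs → f y ∈ filter (λ y → ¬? (f x ≟ y)) ys
      into′ y∈xs = ∈-filter⁺ (λ y → ¬? (f x ≟ y)) (into (there y∈xs))
                             (λ fx≡fy → All.lookup x∉xs y∈xs (inj (here refl) (there y∈xs) fx≡fy))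

  injection-onto : DecidableEquality B → (f : A → B) {xs : List A} {ys : List B} → Unique xs →
                   (∀ {x} → x ∈ xs → f x ∈ ys) → InjectiveOn f xs → length ys ≤ length xs →
                   ∀ {y} → y ∈ ys → ∃ λ x → x ∈ xs × f x ≡ y
  injection-onto _≟_ f {xs} {ys} xs! into inj ys≤xs {y} y∈ys with any? (λ x → f x ≟ y) xs
  ... | yes hit = find hit
  ... | no miss = ⊥-elim (NatP.<⇒≱ (NatP.≤-<-trans xs≤ys′ ys′<ys) ys≤xs)
    where
      ys′<ys : length (filter (λ z → ¬? (z ≟ y)) ys) < length ys
      ys′<ys = filter-notAll (λ z → ¬? (z ≟ y)) ys (Any.map (λ { refl ≢ → ≢ refl }) y∈ys)
      xs≤ys′ : length xs ≤ length (filter (λ z → ¬? (z ≟ y)) ys)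
      xs≤ys′ = length-≤-injection _≟_ f xs!
        (λ x∈xs → ∈-filter⁺ _ (into x∈xs) (λ fx≡y → miss (Any.map (λ { refl → fx≡y }) x∈xs))) inj

  -- The default is returned for values outside the image of xs.
  preimage : DecidableEquality B → (f : A → B) → A → List A → B → A
  preimage _≟_ f default []       y = default
  preimage _≟_ f default (x ∷ xs) y with f x ≟ y
  ... | yes _ = x
  ... | no  _ = preimage _≟_ f default xs y

  preimage-correct : (_≟_ : DecidableEquality B) (f : A → B) (default : A) {xs : List A} {x : A} {y : B} →
                     x ∈ xs → f x ≡ y → f (preimage _≟_ f default xs y) ≡ y
  preimage-correct _≟_ f default {x′ ∷ xs} {y = y} x∈ fx≡y with f x′ ≟ y | x∈
  ... | yes fx′≡y | _          = fx′≡y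
  ... | no  fx′≢y | here refl  = ⊥-elim (fx′≢y fx≡y)
  ... | no  _     | there x∈xs = preimage-correct _≟_ f default x∈xs fx≡y

  unique∧constant⇒length≡1 : {xs : List A} {x : A} → Unique xs → x ∈ xs → (∀ {y} → y ∈ xs → y ≡ x) →
                             length xs ≡ 1
  unique∧constant⇒length≡1 {xs = _ ∷ []}    _                 _ _       = refl
  unique∧constant⇒length≡1 {xs = _ ∷ _ ∷ _} ((y≢z ∷ _) ∷ _) _ all≡x = ⊥-elim (y≢z (trans (all≡x (here refl)) (sym (all≡x (there (here refl))))))

  length≡1⇒∈-unique : {xs : List A} → length xs ≡ 1 → ∀ {x y} → x ∈ xs → y ∈ xs → x ≡ y
  length≡1⇒∈-unique {xs = _ ∷ []} _ (here refl) (here refl) = refl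

  record ListBijection (xs : List A) (ys : List B) : Set where
    field
      to      : A → B
      from    : B → A
      to-∈    : ∀ {x} → x ∈ xs → to x ∈ ys
      from-∈  : ∀ {y} → y ∈ ys → from y ∈ xs
      from∘to : ∀ {x} → x ∈ xs → from (to x) ≡ x
      to∘from : ∀ {y} → y ∈ ys → to (from y) ≡ y

  length-bijection : DecidableEquality A → DecidableEquality B → {xs : List A} {ys : List B} →
                     Unique xs → Unique ys → ListBijection xs ys → length xs ≡ length ys
  length-bijection _≟A_ _≟B_ xs! ys! bij = NatP.≤-antisym
    (length-≤-injection _≟B_ to xs! to-∈ (λ p q e → trans (sym (from∘to p)) (trans (cong from e) (from∘to q))))
    (length-≤-injection _≟A_ from ys! from-∈ (λ p q e → trans (sym (to∘from p)) (trans (cong to e) (to∘from q))))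
    where open ListBijection bij

  length-filterᵇ-map : (p : B → Bool) (f : A → B) (xs : List A) →
                       length (filterᵇ p (List.map f xs)) ≡ length (filterᵇ (p ∘ f) xs)
  length-filterᵇ-map p f [] = refl
  length-filterᵇ-map p f (x ∷ xs) with p (f x)
  ... | true  = cong suc (length-filterᵇ-map p f xs)
  ... | false = length-filterᵇ-map p f xs

  length-filterᵇ-cartesianProduct : (p : A → Bool) (q : B → Bool) (xs : List A) (ys : List B) →
    length (filterᵇ (λ r → p (proj₁ r) ∧ q (proj₂ r)) (cartesianProduct xs ys))
      ≡ length (filterᵇ p xs) * length (filterᵇ q ys)
  length-filterᵇ-cartesianProduct p q [] ys = refl
  length-filterᵇ-cartesianProduct {A = A} {B = B} p q (x ∷ xs) ys = begin
    length (filterᵇ r (List.map (x ,_) ys ++ cartesianProduct xs ys))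
      ≡⟨ cong length (filter-++ (T? ∘ r) (List.map (x ,_) ys) _) ⟩
    length (filterᵇ r (List.map (x ,_) ys) ++ filterᵇ r (cartesianProduct xs ys))
      ≡⟨ length-++ (filterᵇ r (List.map (x ,_) ys)) ⟩
    length (filterᵇ r (List.map (x ,_) ys)) + length (filterᵇ r (cartesianProduct xs ys))
      ≡⟨ cong₂ _+_ (length-filterᵇ-map r (x ,_) ys) (length-filterᵇ-cartesianProduct p q xs ys) ⟩
    length (filterᵇ (λ y → p x ∧ q y) ys) + length (filterᵇ p xs) * length (filterᵇ q ys)
      ≡⟨ first-row ⟩
    length (filterᵇ p (x ∷ xs)) * length (filterᵇ q ys) ∎
    where
      open ≡-Reasoning
      r : A × B → Bool
      r z = p (proj₁ z) ∧ q (proj₂ z)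
      first-row : length (filterᵇ (λ y → p x ∧ q y) ys) + length (filterᵇ p xs) * length (filterᵇ q ys)
                ≡ length (filterᵇ p (x ∷ xs)) * length (filterᵇ q ys)
      first-row with p x
      ... | true  = refl
      ... | false = cong (λ zs → length zs + length (filterᵇ p xs) * length (filterᵇ q ys))
                         (filter-none (T? ∘ λ _ → false) (All.universal (λ _ ()) ys))

  concatMap-map≡cartesianProductWith : {C : Set} (f : A → B → C) (xs : List A) (ys : List B) →
                                       concatMap (λ x → List.map (f x) ys) xs ≡ cartesianProductWith f xs ys
  concatMap-map≡cartesianProductWith f []       ys = refl
  concatMap-map≡cartesianProductWith f (x ∷ xs) ys = cong (List.map (f x) ys ++_) (concatMap-map≡cartesianProductWith f xs ys)

  length-cartesianProductWith : {C : Set} (f : A → B → C) (xs : List A) (ys : List B) →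
                                length (cartesianProductWith f xs ys) ≡ length xs * length ys
  length-cartesianProductWith f [] ys = refl
  length-cartesianProductWith f (x ∷ xs) ys = begin
    length (List.map (f x) ys ++ cartesianProductWith f xs ys)
      ≡⟨ length-++ (List.map (f x) ys) ⟩
    length (List.map (f x) ys) + length (cartesianProductWith f xs ys)
      ≡⟨ cong₂ _+_ (length-map (f x) ys) (length-cartesianProductWith f xs ys) ⟩
    length ys + length xs * length ys ∎
    where open ≡-Reasoning

module VectorEnumeration (F : FiniteField) {A : Set} (xs : List A) where
  open Nat using (_*_; _^_)
  open ListCounting

  allVecsOf-suc : ∀ n → allVecsOf F xs (suc n) ≡ cartesianProductWith _∷_ xs (allVecsOf F xs n)
  allVecsOf-suc n = concatMap-map≡cartesianProductWith _∷_ xs (allVecsOf F xs n)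

  ∈-allVecsOf : (∀ x → x ∈ xs) → ∀ {n} (v : Vec A n) → v ∈ allVecsOf F xs n
  ∈-allVecsOf all∈ [] = here refl
  ∈-allVecsOf all∈ {suc n} (x ∷ v) =
    subst (x ∷ v ∈_) (sym (allVecsOf-suc n)) (∈-cartesianProductWith⁺ _∷_ (all∈ x) (∈-allVecsOf all∈ v))

  allVecsOf-unique : Unique xs → ∀ n → Unique (allVecsOf F xs n)
  allVecsOf-unique xs! zero = [] ∷ []
  allVecsOf-unique xs! (suc n) =
    subst Unique (sym (allVecsOf-suc n)) (cartesianProductWith⁺ _∷_ ∷-injective xs! (allVecsOf-unique xs! n))

  length-allVecsOf : ∀ n → length (allVecsOf F xs n) ≡ length xs ^ n
  length-allVecsOf zero = refl
  length-allVecsOf (suc n) = trans (cong length (allVecsOf-suc n))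
    (trans (length-cartesianProductWith _∷_ xs (allVecsOf F xs n)) (cong (length xs *_) (length-allVecsOf n)))

module FieldProperties (F : FiniteField) where
  open FiniteField F public

  commutativeRing : CommutativeRing 0ℓ 0ℓ
  commutativeRing = record
    { Carrier = Carrier ; _≈_ = _≡_ ; _+_ = _+_ ; _*_ = _*_ ; -_ = -_ ; 0# = 0# ; 1# = 1#
    ; isCommutativeRing = isCommutativeRing }

  open CommutativeRing commutativeRing public
    using ( ring; semiring; +-commutativeSemigroup; *-commutativeSemigroup
          ; +-identityˡ; +-identityʳ; -‿inverseʳ
          ; *-assoc; *-comm; *-identityˡ; *-identityʳ; distribˡ; distribʳ; zeroˡ; zeroʳ )
  open RingProperties ring public
    using ( -‿distribˡ-*; -‿distribʳ-*; -1*x≈-x; x+x≈x⇒x≈0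
          ; +-inverseˡ-unique; +-inverseʳ-unique; x∙y⁻¹≈ε⇒x≈y; x≈y⇒x∙y⁻¹≈ε )
  open SemiringSum semiring public
    using (sum; sum-cong-≗; sum-replicate-zero; sum-remove; ∑-comm; *-distribˡ-sum; *-distribʳ-sum)
  open SemiringExp semiring public using (_^_; ^-homo-*)
  open CommutativeSemigroupProperties +-commutativeSemigroup public using () renaming (interchange to +-interchange)
  open CommutativeSemigroupProperties *-commutativeSemigroup public using (x∙yz≈y∙xz; x∙yz≈yx∙z)

  inv : ∀ x → x ≢ 0# → Carrier
  inv x x≢0 = proj₁ (inverse x x≢0)

  *-inverseʳ : ∀ x (x≢0 : x ≢ 0#) → x * inv x x≢0 ≡ 1#
  *-inverseʳ x x≢0 = proj₂ (inverse x x≢0)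

  *-inverseˡ : ∀ x (x≢0 : x ≢ 0#) → inv x x≢0 * x ≡ 1#
  *-inverseˡ x x≢0 = trans (*-comm _ x) (*-inverseʳ x x≢0)

  1<length-elements : 1 < length elements
  1<length-elements = ListCounting.length-≤-injection _≟_ (λ x → x) {0# ∷ 1# ∷ []} ((0≢1 ∷ []) ∷ [] ∷ [])
                        (λ _ → complete _) (λ _ _ x≡y → x≡y)

  sum-zero : ∀ {n} (f : Fin n → Carrier) → (∀ i → f i ≡ 0#) → sum f ≡ 0#
  sum-zero {n} f f≡0 = trans (sum-cong-≗ f≡0) (sum-replicate-zero n)

  sum-single : ∀ {n} (f : Fin n → Carrier) (i : Fin n) → (∀ j → j ≢ i → f j ≡ 0#) → sum f ≡ f i
  sum-single {suc n} f i others≡0 = begin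
    sum f                        ≡⟨ sum-remove f ⟩
    f i + sum (f ∘ punchIn i)    ≡⟨ cong (f i +_) (sum-zero _ (λ j → others≡0 (punchIn i j) (punchInᵢ≢i i j))) ⟩
    f i + 0#                     ≡⟨ +-identityʳ (f i) ⟩
    f i ∎
    where open ≡-Reasoning

  foldr-zipWith≡sum : ∀ {A B : Set} {n} (f : A → B → Carrier) (u : Vec A n) (v : Vec B n) →
    Vec.foldr (λ _ → Carrier) _+_ 0# (Vec.zipWith f u v) ≡ sum (λ i → f (lookup u i) (lookup v i))
  foldr-zipWith≡sum f [] [] = refl
  foldr-zipWith≡sum f (x ∷ u) (y ∷ v) = cong (f x y +_) (foldr-zipWith≡sum f u v)

module LinearAlgebra (F : FiniteField) where
  open FieldProperties F
  open VectorEnumeration F using (∈-allVecsOf)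
  open Equivalence using (to; from)

  private
    variable
      n : ℕ

  dot≡sum : (u v : Vec Carrier n) → dot F u v ≡ sum (λ i → lookup u i * lookup v i)
  dot≡sum = foldr-zipWith≡sum _*_

  dot-comm : (u v : Vec Carrier n) → dot F u v ≡ dot F v u
  dot-comm [] [] = refl
  dot-comm (x ∷ u) (y ∷ v) = cong₂ _+_ (*-comm x y) (dot-comm u v)

  infixl 6 _⊕_
  infixr 7 _⊙_
  _⊕_ : Vec Carrier n → Vec Carrier n → Vec Carrier n
  _⊕_ = Vec.zipWith _+_

  _⊙_ : Carrier → Vec Carrier n → Vec Carrier n
  t ⊙ v = Vec.map (t *_) v

  dot-⊕ : (x u v : Vec Carrier n) → dot F x (u ⊕ v) ≡ dot F x u + dot F x v
  dot-⊕ [] [] [] = sym (+-identityʳ 0#)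
  dot-⊕ (x ∷ xs) (u ∷ us) (v ∷ vs) = begin
    x * (u + v) + dot F xs (us ⊕ vs)              ≡⟨ cong₂ _+_ (distribˡ x u v) (dot-⊕ xs us vs) ⟩
    (x * u + x * v) + (dot F xs us + dot F xs vs) ≡⟨ +-interchange _ _ _ _ ⟩
    (x * u + dot F xs us) + (x * v + dot F xs vs) ∎
    where open ≡-Reasoning

  dot-⊙ : (x : Vec Carrier n) (t : Carrier) (v : Vec Carrier n) → dot F x (t ⊙ v) ≡ t * dot F x v
  dot-⊙ [] t [] = sym (zeroʳ t)
  dot-⊙ (x ∷ xs) t (v ∷ vs) = begin
    x * (t * v) + dot F xs (t ⊙ vs)  ≡⟨ cong₂ _+_ (x∙yz≈y∙xz x t v) (dot-⊙ xs t vs) ⟩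
    t * (x * v) + t * dot F xs vs    ≡⟨ sym (distribˡ t _ _) ⟩
    t * (x * v + dot F xs vs) ∎
    where open ≡-Reasoning

  dot-zeroˡ : (v : Vec Carrier n) → dot F (zeroVec F n) v ≡ 0#
  dot-zeroˡ [] = refl
  dot-zeroˡ (v ∷ vs) = trans (cong₂ _+_ (zeroˡ v) (dot-zeroˡ vs)) (+-identityʳ 0#)

  infixl 6 _⊖_
  _⊖_ : Vec Carrier n → Vec Carrier n → Vec Carrier n
  u ⊖ v = u ⊕ (- 1#) ⊙ v

  ⊖≡0⇒≡ : (u v : Vec Carrier n) → u ⊖ v ≡ zeroVec F n → u ≡ v
  ⊖≡0⇒≡ {n} u v u⊖v≡0 = lookup-ext λ i → x∙y⁻¹≈ε⇒x≈y (lookup u i) (lookup v i) (begin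
    lookup u i + - lookup v i          ≡⟨ cong (lookup u i +_) (sym (-1*x≈-x (lookup v i))) ⟩
    lookup u i + - 1# * lookup v i     ≡⟨ cong (lookup u i +_) (sym (lookup-map i (- 1# *_) v)) ⟩
    lookup u i + lookup ((- 1#) ⊙ v) i ≡⟨ sym (lookup-zipWith _+_ i u ((- 1#) ⊙ v)) ⟩
    lookup (u ⊖ v) i                   ≡⟨ cong (λ w → lookup w i) u⊖v≡0 ⟩
    lookup (zeroVec F n) i             ≡⟨ lookup-replicate i 0# ⟩
    0# ∎)
    where open ≡-Reasoning

  nonzero-entry : (v : Vec Carrier n) → v ≢ zeroVec F n → ∃ λ i → lookup v i ≢ 0#
  nonzero-entry {n} v v≢0 = ¬∀⟶∃¬ n _ (λ i → lookup v i ≟ 0#)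
    (λ v≗0 → v≢0 (lookup-ext λ i → trans (v≗0 i) (sym (lookup-replicate i 0#))))

  entry : Matrix F n → Fin n → Fin n → Carrier
  entry A i j = lookup (lookup A i) j

  infixr 5 _⊛_
  _⊛_ : Matrix F n → Vec Carrier n → Vec Carrier n
  A ⊛ v = tabulate λ i → dot F (lookup A i) v

  lookup-column : (A : Matrix F n) (i j : Fin n) → lookup (column F A j) i ≡ entry A i j
  lookup-column A i j = lookup-map i (λ row → lookup row j) A

  lookup-⊛ : (A : Matrix F n) (v : Vec Carrier n) (i : Fin n) → lookup (A ⊛ v) i ≡ sum (λ j → entry A i j * lookup v j)
  lookup-⊛ A v i = trans (lookup∘tabulate _ i) (dot≡sum (lookup A i) v)

  entry-· : (A B : Matrix F n) (i k : Fin n) → entry (_·_ F A B) i k ≡ sum (λ j → entry A i j * entry B j k)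
  entry-· A B i k = trans (lookup-tabulate² (λ i k → dot F (lookup A i) (column F B k)) i k)
    (trans (dot≡sum (lookup A i) (column F B k)) (sum-cong-≗ λ j → cong (entry A i j *_) (lookup-column B j k)))

  column-ext : {A B : Matrix F n} → (∀ j → column F A j ≡ column F B j) → A ≡ B
  column-ext {A = A} {B} cols = lookup-ext λ i → lookup-ext λ j →
    trans (sym (lookup-column A i j)) (trans (cong (λ v → lookup v i) (cols j)) (lookup-column B i j))

  ·-⊛ : (A B : Matrix F n) (v : Vec Carrier n) → (_·_ F A B) ⊛ v ≡ A ⊛ (B ⊛ v)
  ·-⊛ A B v = lookup-ext λ i → begin
    lookup ((_·_ F A B) ⊛ v) i
      ≡⟨ lookup-⊛ (_·_ F A B) v i ⟩
    sum (λ k → entry (_·_ F A B) i k * lookup v k)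
      ≡⟨ sum-cong-≗ (λ k → cong (_* lookup v k) (entry-· A B i k)) ⟩
    sum (λ k → sum (λ j → entry A i j * entry B j k) * lookup v k)
      ≡⟨ sum-cong-≗ (λ k → *-distribʳ-sum (lookup v k) (λ j → entry A i j * entry B j k)) ⟩
    sum (λ k → sum (λ j → (entry A i j * entry B j k) * lookup v k))
      ≡⟨ ∑-comm (λ k j → (entry A i j * entry B j k) * lookup v k) ⟩
    sum (λ j → sum (λ k → (entry A i j * entry B j k) * lookup v k))
      ≡⟨ sum-cong-≗ (λ j → trans (sum-cong-≗ (λ k → *-assoc (entry A i j) (entry B j k) (lookup v k)))
                                (sym (*-distribˡ-sum (entry A i j) (λ k → entry B j k * lookup v k)))) ⟩
    sum (λ j → entry A i j * sum (λ k → entry B j k * lookup v k))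
      ≡⟨ sum-cong-≗ (λ j → cong (entry A i j *_) (sym (lookup-⊛ B v j))) ⟩
    sum (λ j → entry A i j * lookup (B ⊛ v) j)
      ≡⟨ sym (lookup-⊛ A (B ⊛ v) i) ⟩
    lookup (A ⊛ (B ⊛ v)) i ∎
    where open ≡-Reasoning

  -- The entries of identity compute only once both indices are constructors, hence the induction.
  lookup-identity-suc : (i : Fin n) → lookup (identity F (suc n)) (suc i) ≡ 0# ∷ lookup (identity F n) i
  lookup-identity-suc i = trans (lookup∘tabulate _ i) (cong (0# ∷_) (sym (lookup∘tabulate _ i)))

  entry-identity-diagonal : (i : Fin n) → entry (identity F n) i i ≡ 1#
  entry-identity-diagonal zero    = refl
  entry-identity-diagonal (suc i) =
    trans (cong (λ row → lookup row (suc i)) (lookup-identity-suc i)) (entry-identity-diagonal i)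

  entry-identity-offDiagonal : (i j : Fin n) → i ≢ j → entry (identity F n) i j ≡ 0#
  entry-identity-offDiagonal zero    zero    i≢j = ⊥-elim (i≢j refl)
  entry-identity-offDiagonal zero    (suc j) _   = lookup∘tabulate _ j
  entry-identity-offDiagonal (suc i) zero    _   = cong (λ row → lookup row zero) (lookup-identity-suc i)
  entry-identity-offDiagonal (suc i) (suc j) i≢j =
    trans (cong (λ row → lookup row (suc j)) (lookup-identity-suc i)) (entry-identity-offDiagonal i j (i≢j ∘ cong suc))

  unit : Fin n → Vec Carrier n
  unit {n} k = column F (identity F n) k

  lookup-unit-diagonal : (k : Fin n) → lookup (unit k) k ≡ 1#
  lookup-unit-diagonal {n} k = trans (lookup-column (identity F n) k k) (entry-identity-diagonal k)

  lookup-unit-offDiagonal : (k j : Fin n) → j ≢ k → lookup (unit k) j ≡ 0#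
  lookup-unit-offDiagonal {n} k j j≢k = trans (lookup-column (identity F n) j k) (entry-identity-offDiagonal j k j≢k)

  dot-unit : (u : Vec Carrier n) (k : Fin n) → dot F u (unit k) ≡ lookup u k
  dot-unit u k = begin
    dot F u (unit k)                           ≡⟨ dot≡sum u (unit k) ⟩
    sum (λ j → lookup u j * lookup (unit k) j) ≡⟨ sum-single _ k (λ j j≢k →
                                                    trans (cong (lookup u j *_) (lookup-unit-offDiagonal k j j≢k)) (zeroʳ _)) ⟩
    lookup u k * lookup (unit k) k             ≡⟨ cong (lookup u k *_) (lookup-unit-diagonal k) ⟩
    lookup u k * 1#                            ≡⟨ *-identityʳ _ ⟩
    lookup u k ∎
    where open ≡-Reasoning

  identity-⊛ : (v : Vec Carrier n) → identity F n ⊛ v ≡ v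
  identity-⊛ {n} v = lookup-ext λ i → begin
    lookup (identity F n ⊛ v) i                        ≡⟨ lookup-⊛ (identity F n) v i ⟩
    sum (λ j → entry (identity F n) i j * lookup v j)  ≡⟨ sum-single _ i (λ j j≢i →
        trans (cong (_* lookup v j) (entry-identity-offDiagonal i j (j≢i ∘ sym))) (zeroˡ _)) ⟩
    entry (identity F n) i i * lookup v i              ≡⟨ cong (_* lookup v i) (entry-identity-diagonal i) ⟩
    1# * lookup v i                                    ≡⟨ *-identityˡ _ ⟩
    lookup v i ∎
    where open ≡-Reasoning

  ⊛-unit : (A : Matrix F n) (k : Fin n) → A ⊛ unit k ≡ column F A k
  ⊛-unit A k = lookup-ext λ i →
    trans (lookup∘tabulate _ i) (trans (dot-unit (lookup A i) k) (sym (lookup-column A i k)))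

  ⊛-ext : {A B : Matrix F n} → (∀ v → A ⊛ v ≡ B ⊛ v) → A ≡ B
  ⊛-ext {A = A} {B} A≗B = column-ext λ k → trans (sym (⊛-unit A k)) (trans (A≗B (unit k)) (⊛-unit B k))

  ⊛-inverse : (B A : Matrix F n) → _·_ F B A ≡ identity F n → ∀ v → B ⊛ A ⊛ v ≡ v
  ⊛-inverse B A BA≡I v = trans (sym (·-⊛ B A v)) (trans (cong (_⊛ v) BA≡I) (identity-⊛ v))

  inverse-unique : {A X Y : Matrix F n} → _·_ F X A ≡ identity F n → _·_ F A Y ≡ identity F n → X ≡ Y
  inverse-unique {A = A} {X} {Y} XA≡I AY≡I = ⊛-ext λ v → begin
    X ⊛ v               ≡⟨ cong (X ⊛_) (sym (⊛-inverse A Y AY≡I v)) ⟩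
    X ⊛ A ⊛ Y ⊛ v       ≡⟨ ⊛-inverse X A XA≡I (Y ⊛ v) ⟩
    Y ⊛ v ∎
    where open ≡-Reasoning

  _IsInverseOf_ : Matrix F n → Matrix F n → Set
  _IsInverseOf_ {n} B A = (_·_ F A B ≡ identity F n) × (_·_ F B A ≡ identity F n)

  T-matEq : {A B : Matrix F n} → T (matEq F A B) ⇔ A ≡ B
  T-matEq {A = A} {B} = T-does (≡-dec (≡-dec _≟_) A B)

  T-isInverseOf : {A B : Matrix F n} → T (isInverseOf F B A) ⇔ B IsInverseOf A
  T-isInverseOf = mk⇔ (Product.map (to T-matEq) (to T-matEq) ∘ to T-∧) (from T-∧ ∘ Product.map (from T-matEq) (from T-matEq))

  ∈-allMatrices : (A : Matrix F n) → A ∈ allMatrices F n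
  ∈-allMatrices {n} = ∈-allVecsOf (allVecs F n) (∈-allVecsOf elements complete) 

  T-isInvertible : {A : Matrix F n} → T (isInvertible F A) ⇔ ∃ λ B → B IsInverseOf A
  T-isInvertible {n} {A} = mk⇔
    (λ t → let (B , _ , B⁻¹) = find (any⁻ (λ B → isInverseOf F B A) (allMatrices F n) t) in
           B , to (T-isInverseOf {A = A} {B}) B⁻¹)
    (λ (B , B⁻¹) → any⁺ (λ B → isInverseOf F B A) (lose (∈-allMatrices B) (from (T-isInverseOf {A = A} {B}) B⁻¹)))

module ExtensionProperties (F K : FiniteField) (h : FieldHom F K) where
  module F = FieldProperties F
  module K = FieldProperties K
  open FieldHom h
  open Extension F K h using (lincomb; coordsOf; isBasis; allBases; f_)
  open LinearAlgebra F
  open ListCounting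
  open VectorEnumeration
  open Equivalence using (to; from)

  private
    variable
      n : ℕ

  ι-0 : ι F.0# ≡ K.0#
  ι-0 = K.x+x≈x⇒x≈0 (ι F.0#) (trans (sym (ι-+ F.0# F.0#)) (cong ι (F.+-identityʳ F.0#)))

  ι-neg : ∀ x → ι (F.- x) ≡ K.- ι x
  ι-neg x = K.+-inverseʳ-unique (ι x) (ι (F.- x)) (trans (sym (ι-+ x (F.- x))) (trans (cong ι (F.-‿inverseʳ x)) ι-0))

  lincomb-⊕ : (b : Vec K.Carrier n) (c c′ : Vec F.Carrier n) → lincomb (c ⊕ c′) b ≡ lincomb c b K.+ lincomb c′ b
  lincomb-⊕ [] [] [] = sym (K.+-identityʳ K.0#)
  lincomb-⊕ (β ∷ b) (x ∷ c) (x′ ∷ c′) = begin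
    ι (x F.+ x′) K.* β K.+ lincomb (c ⊕ c′) b
      ≡⟨ cong₂ K._+_ (trans (cong (K._* β) (ι-+ x x′)) (K.distribʳ β (ι x) (ι x′))) (lincomb-⊕ b c c′) ⟩
    (ι x K.* β K.+ ι x′ K.* β) K.+ (lincomb c b K.+ lincomb c′ b)
      ≡⟨ K.+-interchange _ _ _ _ ⟩
    (ι x K.* β K.+ lincomb c b) K.+ (ι x′ K.* β K.+ lincomb c′ b) ∎
    where open ≡-Reasoning

  lincomb-⊙ : (b : Vec K.Carrier n) (t : F.Carrier) (c : Vec F.Carrier n) → lincomb (t ⊙ c) b ≡ ι t K.* lincomb c b
  lincomb-⊙ [] t [] = sym (K.zeroʳ (ι t))
  lincomb-⊙ (β ∷ b) t (x ∷ c) = begin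
    ι (t F.* x) K.* β K.+ lincomb (t ⊙ c) b     ≡⟨ cong₂ K._+_ (trans (cong (K._* β) (ι-* t x)) (K.*-assoc _ _ _))
                                                               (lincomb-⊙ b t c) ⟩
    ι t K.* (ι x K.* β) K.+ ι t K.* lincomb c b ≡⟨ sym (K.distribˡ (ι t) _ _) ⟩
    ι t K.* (ι x K.* β K.+ lincomb c b) ∎
    where open ≡-Reasoning

  lincomb-⊖ : (b : Vec K.Carrier n) (c c′ : Vec F.Carrier n) → lincomb (c ⊖ c′) b ≡ lincomb c b K.+ K.- lincomb c′ b
  lincomb-⊖ b c c′ = begin
    lincomb (c ⊕ (F.- F.1#) ⊙ c′) b                  ≡⟨ lincomb-⊕ b c ((F.- F.1#) ⊙ c′) ⟩
    lincomb c b K.+ lincomb ((F.- F.1#) ⊙ c′) b      ≡⟨ cong (lincomb c b K.+_) (lincomb-⊙ b (F.- F.1#) c′) ⟩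
    lincomb c b K.+ ι (F.- F.1#) K.* lincomb c′ b    ≡⟨ cong (λ z → lincomb c b K.+ z K.* lincomb c′ b)
                                                             (trans (ι-neg F.1#) (cong K.-_ ι-1)) ⟩
    lincomb c b K.+ K.- K.1# K.* lincomb c′ b        ≡⟨ cong (lincomb c b K.+_) (K.-1*x≈-x _) ⟩
    lincomb c b K.+ K.- lincomb c′ b ∎
    where open ≡-Reasoning

  lincomb-map-* : (γ : K.Carrier) (b : Vec K.Carrier n) (c : Vec F.Carrier n) →
                  γ K.* lincomb c b ≡ lincomb c (Vec.map (γ K.*_) b)
  lincomb-map-* γ [] [] = K.zeroʳ γ
  lincomb-map-* γ (β ∷ b) (x ∷ c) = begin
    γ K.* (ι x K.* β K.+ lincomb c b)            ≡⟨ K.distribˡ γ _ _ ⟩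
    γ K.* (ι x K.* β) K.+ γ K.* lincomb c b      ≡⟨ cong₂ K._+_ (K.x∙yz≈y∙xz γ (ι x) β) (lincomb-map-* γ b c) ⟩
    ι x K.* (γ K.* β) K.+ lincomb c (Vec.map (γ K.*_) b) ∎
    where open ≡-Reasoning

  lincomb-unit : (b : Vec K.Carrier n) (k : Fin n) → lincomb (unit k) b ≡ lookup b k
  lincomb-unit b k = begin
    lincomb (unit k) b                                   ≡⟨ K.foldr-zipWith≡sum _ (unit k) b ⟩
    K.sum (λ j → ι (lookup (unit k) j) K.* lookup b j)   ≡⟨ K.sum-single _ k (λ j j≢k →
        trans (cong (λ t → ι t K.* lookup b j) (lookup-unit-offDiagonal k j j≢k)) (trans (cong (K._* lookup b j) ι-0) (K.zeroˡ _))) ⟩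
    ι (lookup (unit k) k) K.* lookup b k                 ≡⟨ cong (λ t → ι t K.* lookup b k) (lookup-unit-diagonal k) ⟩
    ι F.1# K.* lookup b k                                ≡⟨ trans (cong (K._* lookup b k) ι-1) (K.*-identityˡ _) ⟩
    lookup b k ∎
    where open ≡-Reasoning

  record IsLinear (ℓ : K.Carrier → F.Carrier) : Set where
    field
      additive    : ∀ x y → ℓ (x K.+ y) ≡ ℓ x F.+ ℓ y
      homogeneous : ∀ t x → ℓ (ι t K.* x) ≡ t F.* ℓ x

  IsLinearMap : (K.Carrier → Vec F.Carrier n) → Set
  IsLinearMap φ = ∀ i → IsLinear (λ γ → lookup (φ γ) i)

  module _ {ℓ : K.Carrier → F.Carrier} (ℓ-linear : IsLinear ℓ) where
    open IsLinear ℓ-linear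

    linear-0 : ℓ K.0# ≡ F.0#
    linear-0 = F.x+x≈x⇒x≈0 _ (trans (sym (additive K.0# K.0#)) (cong ℓ (K.+-identityʳ K.0#)))

    linear-neg : ∀ x → ℓ (K.- x) ≡ F.- ℓ x
    linear-neg x = F.+-inverseʳ-unique (ℓ x) (ℓ (K.- x))
      (trans (sym (additive x (K.- x))) (trans (cong ℓ (K.-‿inverseʳ x)) linear-0))

    linear-lincomb : (b : Vec K.Carrier n) (c : Vec F.Carrier n) → ℓ (lincomb c b) ≡ dot F c (Vec.map ℓ b)
    linear-lincomb []      []      = linear-0
    linear-lincomb (β ∷ b) (x ∷ c) = trans (additive _ _) (cong₂ F._+_ (homogeneous x β) (linear-lincomb b c))

    linear-*ˡ : ∀ β → IsLinear (λ γ → ℓ (β K.* γ))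
    linear-*ˡ β = record
      { additive    = λ x y → trans (cong ℓ (K.distribˡ β x y)) (additive _ _)
      ; homogeneous = λ t x → trans (cong ℓ (K.x∙yz≈y∙xz β (ι t) x)) (homogeneous t _)
      }

  dot-linear : {φ : K.Carrier → Vec F.Carrier n} → IsLinearMap φ → ∀ x → IsLinear (λ γ → dot F x (φ γ))
  dot-linear {φ = φ} φ-linear x = record
    { additive    = λ γ γ′ → trans (cong (dot F x) (lookup-ext λ i →
                      trans (IsLinear.additive (φ-linear i) γ γ′) (sym (lookup-zipWith F._+_ i (φ γ) (φ γ′)))))
                      (dot-⊕ x (φ γ) (φ γ′))
    ; homogeneous = λ t γ → trans (cong (dot F x) (lookup-ext λ i →
                      trans (IsLinear.homogeneous (φ-linear i) t γ) (sym (lookup-map i (t F.*_) (φ γ)))))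
                      (dot-⊙ x t (φ γ))
    }

  tabulate-linear : {ℓ : Fin n → K.Carrier → F.Carrier} → (∀ i → IsLinear (ℓ i)) →
                    IsLinearMap (λ γ → tabulate λ i → ℓ i γ)
  tabulate-linear {ℓ = ℓ} ℓ-linear i = record
    { additive    = λ x y → trans (lookup∘tabulate _ i)
        (trans (IsLinear.additive (ℓ-linear i) x y) (sym (cong₂ F._+_ (lookup∘tabulate _ i) (lookup∘tabulate _ i))))
    ; homogeneous = λ t x → trans (lookup∘tabulate _ i)
        (trans (IsLinear.homogeneous (ℓ-linear i) t x) (sym (cong (t F.*_) (lookup∘tabulate _ i))))
    }

  ⊛-columns : {φ : K.Carrier → Vec F.Carrier n} → IsLinearMap φ → (A : Matrix F n) (b : Vec K.Carrier n) →
              (∀ k → column F A k ≡ φ (lookup b k)) → ∀ c → A ⊛ c ≡ φ (lincomb c b)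
  ⊛-columns {φ = φ} φ-linear A b columns c = lookup-ext λ i → begin
    lookup (A ⊛ c) i                             ≡⟨ lookup∘tabulate _ i ⟩
    dot F (lookup A i) c                         ≡⟨ dot-comm _ c ⟩
    dot F c (lookup A i)                         ≡⟨ cong (dot F c) (row i) ⟩
    dot F c (Vec.map (λ γ → lookup (φ γ) i) b)   ≡⟨ sym (linear-lincomb (φ-linear i) b c) ⟩
    lookup (φ (lincomb c b)) i ∎
    where
      open ≡-Reasoning
      row : ∀ i → lookup A i ≡ Vec.map (λ γ → lookup (φ γ) i) b
      row i = lookup-ext λ k → trans (sym (lookup-column A i k))
        (trans (cong (λ v → lookup v i) (columns k)) (sym (lookup-map k (λ γ → lookup (φ γ) i) b)))

  ∈-coordsOf : {b : Vec K.Carrier n} {γ : K.Carrier} {c : Vec F.Carrier n} → c ∈ coordsOf b γ ⇔ lincomb c b ≡ γ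
  ∈-coordsOf {n} {b} {γ} {c} = mk⇔
    (to (T-does (lincomb c b K.≟ γ)) ∘ proj₂ ∘ ∈-filterᵇ⁻ _ (allVecs F n))
    (∈-filterᵇ⁺ _ (∈-allVecsOf F F.elements F.complete c) ∘ from (T-does (lincomb c b K.≟ γ)))

  f-∈-coordsOf : (b : Vec K.Carrier n) (γ : K.Carrier) → length (coordsOf b γ) ≡ 1 → f_ b γ ∈ coordsOf b γ
  f-∈-coordsOf b γ _ with coordsOf b γ
  ... | _ ∷ _ = here refl

  record Basis (b : Vec K.Carrier n) : Set where
    field
      lincomb-f         : ∀ γ → lincomb (f_ b γ) b ≡ γ
      lincomb-injective : ∀ {c c′} → lincomb c b ≡ lincomb c′ b → c ≡ c′

  isBasis⇒Basis : {b : Vec K.Carrier n} → T (isBasis b) → Basis b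
  isBasis⇒Basis {b = b} t = record
    { lincomb-f         = λ γ → to ∈-coordsOf (f-∈-coordsOf b γ (unique-coords γ))
    ; lincomb-injective = λ {c} {c′} c≡c′ →
        length≡1⇒∈-unique (unique-coords (lincomb c b))
                          (from (∈-coordsOf {c = c}) refl) (from (∈-coordsOf {c = c′}) (sym c≡c′))
    }
    where
      unique-coords : ∀ γ → length (coordsOf b γ) ≡ 1
      unique-coords γ = to (T-does (length (coordsOf b γ) Nat.≟ 1)) (All.lookup (all⁺ _ K.elements t) (K.complete γ))

  spanning∧independent⇒isBasis : (b : Vec K.Carrier n) → (∀ γ → ∃ λ c → lincomb c b ≡ γ) →
                                 (∀ {c c′} → lincomb c b ≡ lincomb c′ b → c ≡ c′) → T (isBasis b)
  spanning∧independent⇒isBasis {n} b spanning independent =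
    all⁻ _ (All.universal (λ γ → from (T-does (length (coordsOf b γ) Nat.≟ 1)) (unique-coords γ)) K.elements)
    where
      unique-coords : ∀ γ → length (coordsOf b γ) ≡ 1
      unique-coords γ with spanning γ
      ... | c , refl = unique∧constant⇒length≡1 (filterᵇ-unique (allVecsOf-unique F F.elements F.unique n))
                                                (from (∈-coordsOf {c = c}) refl)
                                (λ c′∈ → independent (to ∈-coordsOf c′∈))

  functional : Vec K.Carrier n → Vec F.Carrier n → K.Carrier → F.Carrier
  functional b x γ = dot F x (f_ b γ)

  module _ {b : Vec K.Carrier n} (B : Basis b) where
    open Basis B

    f-unique : ∀ {c γ} → lincomb c b ≡ γ → f_ b γ ≡ c
    f-unique {c} refl = lincomb-injective (lincomb-f (lincomb c b))

    f-injective : ∀ {γ γ′} → f_ b γ ≡ f_ b γ′ → γ ≡ γ′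
    f-injective {γ} {γ′} e = trans (sym (lincomb-f γ)) (trans (cong (λ c → lincomb c b) e) (lincomb-f γ′))

    f-lookup : ∀ k → f_ b (lookup b k) ≡ unit k
    f-lookup k = f-unique (lincomb-unit b k)

    f-linear : IsLinearMap (f_ b)
    f-linear i = record
      { additive    = λ x y → trans (cong (λ v → lookup v i) (f-unique {c = f_ b x ⊕ f_ b y}
                                  (trans (lincomb-⊕ b (f_ b x) (f_ b y)) (cong₂ K._+_ (lincomb-f x) (lincomb-f y)))))
                                  (lookup-zipWith F._+_ i (f_ b x) (f_ b y))
      ; homogeneous = λ t x → trans (cong (λ v → lookup v i) (f-unique {c = t ⊙ f_ b x}
                                  (trans (lincomb-⊙ b t (f_ b x)) (cong (ι t K.*_) (lincomb-f x)))))
                                  (lookup-map i (t F.*_) (f_ b x))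
      }

    functional-linear : ∀ x → IsLinear (functional b x)
    functional-linear = dot-linear f-linear

    functional-lookup : ∀ x k → functional b x (lookup b k) ≡ lookup x k
    functional-lookup x k = trans (cong (dot F x) (f-lookup k)) (dot-unit x k)

    functional-map : ∀ {ℓ} → IsLinear ℓ → ∀ γ → functional b (Vec.map ℓ b) γ ≡ ℓ γ
    functional-map {ℓ} ℓ-linear γ = begin
      dot F (Vec.map ℓ b) (f_ b γ)   ≡⟨ dot-comm (Vec.map ℓ b) (f_ b γ) ⟩
      dot F (f_ b γ) (Vec.map ℓ b)   ≡⟨ sym (linear-lincomb ℓ-linear b (f_ b γ)) ⟩
      ℓ (lincomb (f_ b γ) b)         ≡⟨ cong ℓ (lincomb-f γ) ⟩
      ℓ γ ∎
      where open ≡-Reasoning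

  nonzero-functional : {b : Vec K.Carrier n} → Basis b → ∀ {y} → y ≢ zeroVec F n → ∃ λ ε → functional b y ε ≢ F.0#
  nonzero-functional {b = b} B {y} y≢0 =
    let (i , yᵢ≢0) = nonzero-entry y y≢0 in lookup b i , yᵢ≢0 ∘ trans (sym (functional-lookup B y i))

  columns-invertible⇒isBasis : {φ : K.Carrier → Vec F.Carrier n} → IsLinearMap φ →
                               (∀ {γ γ′} → φ γ ≡ φ γ′ → γ ≡ γ′) →
                               {E E′ : Matrix F n} → E′ IsInverseOf E → (b : Vec K.Carrier n) →
                               (∀ k → φ (lookup b k) ≡ column F E k) → T (isBasis b)
  columns-invertible⇒isBasis {φ = φ} φ-linear φ-injective {E} {E′} (EE′≡I , E′E≡I) b φ∘b≡E =
    spanning∧independent⇒isBasis b spanning independent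
    where
      E⊛ : ∀ c → E ⊛ c ≡ φ (lincomb c b)
      E⊛ = ⊛-columns {φ = φ} φ-linear E b (λ k → sym (φ∘b≡E k))
      spanning : ∀ γ → ∃ λ c → lincomb c b ≡ γ
      spanning γ = E′ ⊛ φ γ , φ-injective (trans (sym (E⊛ (E′ ⊛ φ γ))) (⊛-inverse E E′ EE′≡I (φ γ)))
      independent : ∀ {c c′} → lincomb c b ≡ lincomb c′ b → c ≡ c′
      independent {c} {c′} e = trans (sym (⊛-inverse E′ E E′E≡I c))
        (trans (cong (E′ ⊛_) (trans (E⊛ c) (trans (cong φ e) (sym (E⊛ c′))))) (⊛-inverse E′ E E′E≡I c′))

  trivial-kernel⇒injective : {φ : K.Carrier → Vec F.Carrier n} → IsLinearMap φ →
                             (∀ {δ} → φ δ ≡ zeroVec F n → δ ≡ K.0#) → ∀ {γ γ′} → φ γ ≡ φ γ′ → γ ≡ γ′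
  trivial-kernel⇒injective {φ = φ} φ-linear kernel-trivial {γ} {γ′} φγ≡φγ′ =
    K.x∙y⁻¹≈ε⇒x≈y γ γ′ (kernel-trivial (lookup-ext λ i → begin
      lookup (φ (γ K.+ K.- γ′)) i                       ≡⟨ IsLinear.additive (φ-linear i) γ (K.- γ′) ⟩
      lookup (φ γ) i F.+ lookup (φ (K.- γ′)) i          ≡⟨ cong (lookup (φ γ) i F.+_) (linear-neg (φ-linear i) γ′) ⟩
      lookup (φ γ) i F.+ F.- lookup (φ γ′) i            ≡⟨ F.x≈y⇒x∙y⁻¹≈ε (cong (λ v → lookup v i) φγ≡φγ′) ⟩
      F.0#                                              ≡⟨ sym (lookup-replicate i F.0#) ⟩
      lookup (zeroVec F _) i ∎))
    where open ≡-Reasoning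

  coordinateMatrix : Vec K.Carrier n → Vec K.Carrier n → Matrix F n
  coordinateMatrix b w = tabulate λ i → tabulate λ k → lookup (f_ b (lookup w k)) i

  column-coordinateMatrix : (b w : Vec K.Carrier n) (k : Fin n) → column F (coordinateMatrix b w) k ≡ f_ b (lookup w k)
  column-coordinateMatrix b w k = lookup-ext λ i →
    trans (lookup-column (coordinateMatrix b w) i k) (lookup-tabulate² (λ i k → lookup (f_ b (lookup w k)) i) i k)

  coordinateMatrix-⊛ : {b : Vec K.Carrier n} → Basis b → ∀ w c → coordinateMatrix b w ⊛ c ≡ f_ b (lincomb c w)
  coordinateMatrix-⊛ {b = b} B w = ⊛-columns {φ = f_ b} (f-linear B) (coordinateMatrix b w) w (column-coordinateMatrix b w)

  coordinateMatrix-· : {b w : Vec K.Carrier n} → Basis b → Basis w →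
                       _·_ F (coordinateMatrix b w) (coordinateMatrix w b) ≡ identity F n
  coordinateMatrix-· {b = b} {w} B W = ⊛-ext λ v → begin
    _·_ F (coordinateMatrix b w) (coordinateMatrix w b) ⊛ v   ≡⟨ ·-⊛ (coordinateMatrix b w) (coordinateMatrix w b) v ⟩
    coordinateMatrix b w ⊛ coordinateMatrix w b ⊛ v           ≡⟨ cong (coordinateMatrix b w ⊛_) (coordinateMatrix-⊛ W b v) ⟩
    coordinateMatrix b w ⊛ f_ w (lincomb v b)                 ≡⟨ coordinateMatrix-⊛ B w _ ⟩
    f_ b (lincomb (f_ w (lincomb v b)) w)                     ≡⟨ cong (f_ b) (Basis.lincomb-f W _) ⟩
    f_ b (lincomb v b)                                        ≡⟨ f-unique B refl ⟩
    v                                                         ≡⟨ sym (identity-⊛ v) ⟩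
    identity F _ ⊛ v ∎
    where open ≡-Reasoning

  coordinateMatrix-inverse : {b w : Vec K.Carrier n} → Basis b → Basis w →
                             coordinateMatrix w b IsInverseOf coordinateMatrix b w
  coordinateMatrix-inverse B W = coordinateMatrix-· B W , coordinateMatrix-· W B

  module _ {b₀ : Vec K.Carrier n} (B₀ : Basis b₀) where

    basisWithCoordinates : Matrix F n → Vec K.Carrier n
    basisWithCoordinates P = tabulate λ k → lincomb (column F P k) b₀

    f-basisWithCoordinates : ∀ P k → f_ b₀ (lookup (basisWithCoordinates P) k) ≡ column F P k
    f-basisWithCoordinates P k = f-unique B₀ (sym (lookup∘tabulate _ k))

    invertible≃bases : ListBijection (filterᵇ (isInvertible F) (allMatrices F n)) (allBases n)
    invertible≃bases = record
      { to      = basisWithCoordinates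
      ; from    = coordinateMatrix b₀
      ; to-∈    = to-∈
      ; from-∈  = from-∈
      ; from∘to = λ {P} _ → column-ext λ k →
                    trans (column-coordinateMatrix b₀ (basisWithCoordinates P) k) (f-basisWithCoordinates P k)
      ; to∘from = λ {b} _ → lookup-ext λ k → trans (lookup∘tabulate _ k)
                    (trans (cong (λ c → lincomb c b₀) (column-coordinateMatrix b₀ b k)) (Basis.lincomb-f B₀ _))
      }
      where
        to-∈ : ∀ {P} → P ∈ filterᵇ (isInvertible F) (allMatrices F n) → basisWithCoordinates P ∈ allBases n
        to-∈ {P} P∈ = ∈-filterᵇ⁺ isBasis (∈-allVecsOf K K.elements K.complete (basisWithCoordinates P))
          (columns-invertible⇒isBasis {φ = f_ b₀} (f-linear B₀) (f-injective B₀)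
            (proj₂ (to (T-isInvertible {A = P}) (proj₂ (∈-filterᵇ⁻ (isInvertible F) (allMatrices F n) P∈))))
            (basisWithCoordinates P) (f-basisWithCoordinates P))
        from-∈ : ∀ {b} → b ∈ allBases n → coordinateMatrix b₀ b ∈ filterᵇ (isInvertible F) (allMatrices F n)
        from-∈ {b} b∈ = ∈-filterᵇ⁺ (isInvertible F) (∈-allMatrices (coordinateMatrix b₀ b))
          (from T-isInvertible (coordinateMatrix b b₀ ,
            coordinateMatrix-inverse B₀ (isBasis⇒Basis (proj₂ (∈-filterᵇ⁻ isBasis (allVecs K n) b∈)))))

    GLcount≡length-allBases : GLcount F n ≡ length (allBases n)
    GLcount≡length-allBases = length-bijection (≡-dec (≡-dec F._≟_)) (≡-dec K._≟_)
      (filterᵇ-unique (allVecsOf-unique F (allVecs F n) (allVecsOf-unique F F.elements F.unique n) n))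
      (filterᵇ-unique (allVecsOf-unique K K.elements K.unique n))
      invertible≃bases

    coordinates≃elements : ListBijection (allVecs F n) K.elements
    coordinates≃elements = record
      { to      = λ c → lincomb c b₀
      ; from    = f_ b₀
      ; to-∈    = λ _ → K.complete _
      ; from-∈  = λ _ → ∈-allVecsOf F F.elements F.complete _
      ; from∘to = λ _ → f-unique B₀ refl
      ; to∘from = λ _ → Basis.lincomb-f B₀ _
      }

    length-K-elements : length K.elements ≡ length F.elements Nat.^ n
    length-K-elements = trans
      (sym (length-bijection (≡-dec F._≟_) K._≟_ (allVecsOf-unique F F.elements F.unique n) K.unique coordinates≃elements))
      (length-allVecsOf F F.elements n)

    more-than-dimension⇒dependent : (w : Vec K.Carrier (suc n)) →
                                    ¬ (∀ {c c′} → lincomb c w ≡ lincomb c′ w → c ≡ c′)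
    more-than-dimension⇒dependent w independent =
      NatP.<⇒≱ (NatP.^-monoʳ-< q F.1<length-elements (NatP.n<1+n n)) (begin
      q Nat.^ suc n                    ≡⟨ sym (length-allVecsOf F F.elements (suc n)) ⟩
      length (allVecs F (suc n))       ≤⟨ length-≤-injection K._≟_ (λ c → lincomb c w)
                                            (allVecsOf-unique F F.elements F.unique (suc n))
                                            (λ _ → K.complete _) (λ _ _ → independent) ⟩
      length K.elements                ≡⟨ length-K-elements ⟩
      q Nat.^ n ∎)
      where
        open NatP.≤-Reasoning
        q : ℕ
        q = length F.elements

module Krylov (F K : FiniteField) (h : FieldHom F K) (α : FiniteField.Carrier K) where
  open ExtensionProperties F K h
  open FieldHom h
  open Extension F K h using (lincomb; f_; M; D; _^_)
  open LinearAlgebra F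
  open ListCounting
  open VectorEnumeration
  open Equivalence using (to; from)

  private
    variable
      n : ℕ

  -- Highest power first, so that the leading coefficient of a relation is the head of its vector.
  descendingPowers : ∀ m → Vec K.Carrier m
  descendingPowers zero    = []
  descendingPowers (suc m) = α K.^ m ∷ descendingPowers m

  PowerRelation : ℕ → Set
  PowerRelation m = ∃ λ (r : Vec F.Carrier m) → α K.^ m ≡ lincomb r (descendingPowers m)

  dependence⇒PowerRelation : ∀ {N} (d : Vec F.Carrier N) → d ≢ zeroVec F N →
                             lincomb d (descendingPowers N) ≡ K.0# → ∃ λ m → m < N × PowerRelation m
  dependence⇒PowerRelation [] d≢0 _ = ⊥-elim (d≢0 refl)
  dependence⇒PowerRelation {suc N} (x ∷ d) d≢0 x∷d≡0 with x F.≟ F.0#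
  ... | yes refl = Product.map₂ (Product.map₁ NatP.m<n⇒m<1+n)
                     (dependence⇒PowerRelation d (d≢0 ∘ cong (F.0# ∷_)) d≡0)
    where
      d≡0 : lincomb d (descendingPowers N) ≡ K.0#
      d≡0 = trans (sym (trans (cong (K._+ lincomb d (descendingPowers N)) (trans (cong (K._* α K.^ N) ι-0) (K.zeroˡ _)))
                              (K.+-identityˡ _)))
                  x∷d≡0
  ... | no x≢0 = N , NatP.n<1+n N , (F.- u) ⊙ d , top
    where
      u : F.Carrier
      u = F.inv x x≢0
      L : K.Carrier
      L = lincomb d (descendingPowers N)
      ι[u*x]≡1 : ι u K.* ι x ≡ K.1#
      ι[u*x]≡1 = trans (sym (ι-* u x)) (trans (cong ι (F.*-inverseˡ x x≢0)) ι-1)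
      top : α K.^ N ≡ lincomb ((F.- u) ⊙ d) (descendingPowers N)
      top = begin
        α K.^ N                              ≡⟨ sym (K.*-identityˡ _) ⟩
        K.1# K.* α K.^ N                     ≡⟨ cong (K._* α K.^ N) ι[u*x]≡1 ⟨
        (ι u K.* ι x) K.* α K.^ N            ≡⟨ K.*-assoc _ _ _ ⟩
        ι u K.* (ι x K.* α K.^ N)            ≡⟨ cong (ι u K.*_) (K.+-inverseˡ-unique _ L x∷d≡0) ⟩
        ι u K.* K.- L                        ≡⟨ sym (K.-‿distribʳ-* (ι u) L) ⟩
        K.- (ι u K.* L)                      ≡⟨ K.-‿distribˡ-* (ι u) L ⟩
        K.- ι u K.* L                        ≡⟨ cong (K._* L) (sym (ι-neg u)) ⟩
        ι (F.- u) K.* L                      ≡⟨ sym (lincomb-⊙ (descendingPowers N) (F.- u) d) ⟩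
        lincomb ((F.- u) ⊙ d) (descendingPowers N) ∎
        where open ≡-Reasoning

  -- Doubly negated since counting only refutes injectivity; enough, as it only serves to derive ⊥.
  PowerRelation-below-dimension : {b₀ : Vec K.Carrier n} → Basis b₀ → ¬ ¬ (∃ λ m → m ≤ n × PowerRelation m)
  PowerRelation-below-dimension {n} B₀ no-relation =
    more-than-dimension⇒dependent B₀ (descendingPowers (suc n)) independent
    where
      independent : ∀ {c c′} → lincomb c (descendingPowers (suc n)) ≡ lincomb c′ (descendingPowers (suc n)) → c ≡ c′
      independent {c} {c′} same with ≡-dec F._≟_ c c′
      ... | yes c≡c′ = c≡c′
      ... | no c≢c′ = ⊥-elim (no-relation (Product.map₂ (Product.map₁ NatP.≤-pred)
              (dependence⇒PowerRelation (c ⊖ c′) (c≢c′ ∘ ⊖≡0⇒≡ c c′)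
                (trans (lincomb-⊖ _ c c′) (K.x≈y⇒x∙y⁻¹≈ε same)))))

  map-descendingPowers : ∀ m (g : K.Carrier → F.Carrier) → (∀ j → j < m → g (α K.^ j) ≡ F.0#) →
                         Vec.map g (descendingPowers m) ≡ zeroVec F m
  map-descendingPowers zero    g _      = refl
  map-descendingPowers (suc m) g g≡0 =
    cong₂ _∷_ (g≡0 m (NatP.n<1+n m)) (map-descendingPowers m g (λ j j<m → g≡0 j (NatP.m<n⇒m<1+n j<m)))

  vanishing-on-powers : ∀ {ℓ} → IsLinear ℓ → ∀ {m} → PowerRelation m →
                        (∀ j → j < m → ℓ (α K.^ j) ≡ F.0#) → ∀ k → ℓ (α K.^ k) ≡ F.0#
  vanishing-on-powers {ℓ} ℓ-linear {m} (r , α^m≡) low = <-rec (λ k → ℓ (α K.^ k) ≡ F.0#) step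
    where
      step : ∀ k → (∀ {j} → j < k → ℓ (α K.^ j) ≡ F.0#) → ℓ (α K.^ k) ≡ F.0#
      step k below with k NatP.<? m
      ... | yes k<m = low k k<m
      ... | no k≮m = begin
        ℓ (α K.^ k)                                       ≡⟨ cong (λ e → ℓ (α K.^ e)) (sym t+m≡k) ⟩
        ℓ (α K.^ (t Nat.+ m))                             ≡⟨ cong ℓ (K.^-homo-* α t m) ⟩
        ℓ (α K.^ t K.* α K.^ m)                           ≡⟨ cong (λ γ → ℓ (α K.^ t K.* γ)) α^m≡ ⟩
        ℓ (α K.^ t K.* lincomb r (descendingPowers m))    ≡⟨ linear-lincomb (linear-*ˡ ℓ-linear (α K.^ t))
                                                                              (descendingPowers m) r ⟩
        dot F r (Vec.map (λ γ → ℓ (α K.^ t K.* γ)) (descendingPowers m))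
                                                          ≡⟨ cong (dot F r) (map-descendingPowers m _ shifted-below) ⟩
        dot F r (zeroVec F m)                             ≡⟨ trans (dot-comm r _) (dot-zeroˡ r) ⟩
        F.0# ∎
        where
          open ≡-Reasoning
          t : ℕ
          t = k Nat.∸ m
          t+m≡k : t Nat.+ m ≡ k
          t+m≡k = NatP.m∸n+n≡m (NatP.≮⇒≥ k≮m)
          shifted-below : ∀ j → j < m → ℓ (α K.^ t K.* α K.^ j) ≡ F.0#
          shifted-below j j<m = trans (cong ℓ (sym (K.^-homo-* α t j)))
            (below (NatP.<-≤-trans (NatP.+-monoʳ-< t j<m) (NatP.≤-reflexive t+m≡k)))

  Generates : Set
  Generates = ∀ γ → γ ≢ K.0# → ∃ λ k → α K.^ k ≡ γ

  -- The power function of IsGenerator is local to Defs and cannot be named; same-powers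
  -- identifies it with _^_ by its defining equations, leaving the function to unification.
  IsGenerator⇒Generates : Extension.IsGenerator F K h α → Generates
  IsGenerator⇒Generates generator γ γ≢0 = same-powers refl (λ _ → refl) (generator γ γ≢0)
    where
      same-powers : {p : ℕ → K.Carrier} → p 0 ≡ K.1# → (∀ m → p (suc m) ≡ p m K.* α) →
                    (∃ λ k → p k ≡ γ) → ∃ λ k → α K.^ k ≡ γ
      same-powers {p} p0≡1 p-suc = Product.map₂ λ {k} pk≡γ → trans (sym (p≗α^ k)) pk≡γ
        where
          p≗α^ : ∀ k → p k ≡ α K.^ k
          p≗α^ zero    = p0≡1
          p≗α^ (suc k) = trans (p-suc k) (trans (cong (K._* α) (p≗α^ k)) (K.*-comm _ α))

  generates-transitively : Generates → ∀ {x y} → x ≢ K.0# → y ≢ K.0# → ∃ λ k → α K.^ k K.* x ≡ y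
  generates-transitively generates {x} {y} x≢0 y≢0 = Product.map₂ (λ {k} α^k≡y/x → begin
      α K.^ k K.* x                 ≡⟨ cong (K._* x) α^k≡y/x ⟩
      (y K.* K.inv x x≢0) K.* x     ≡⟨ K.*-assoc _ _ _ ⟩
      y K.* (K.inv x x≢0 K.* x)     ≡⟨ cong (y K.*_) (K.*-inverseˡ x x≢0) ⟩
      y K.* K.1#                    ≡⟨ K.*-identityʳ y ⟩
      y ∎)
    (generates (y K.* K.inv x x≢0) y/x≢0)
    where
      open ≡-Reasoning
      y/x≢0 : y K.* K.inv x x≢0 ≢ K.0#
      y/x≢0 y/x≡0 = y≢0 (begin
        y                             ≡⟨ sym (K.*-identityʳ y) ⟩
        y K.* K.1#                    ≡⟨ cong (y K.*_) (sym (K.*-inverseˡ x x≢0)) ⟩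
        y K.* (K.inv x x≢0 K.* x)     ≡⟨ sym (K.*-assoc _ _ _) ⟩
        (y K.* K.inv x x≢0) K.* x     ≡⟨ cong (K._* x) y/x≡0 ⟩
        K.0# K.* x                    ≡⟨ K.zeroˡ x ⟩
        K.0# ∎)

  krylov : (K.Carrier → F.Carrier) → K.Carrier → Vec F.Carrier n
  krylov ℓ γ = tabulate λ j → ℓ (α K.^ toℕ j K.* γ)

  krylov-linear : ∀ {ℓ} → IsLinear ℓ → IsLinearMap (krylov {n} ℓ)
  krylov-linear ℓ-linear = tabulate-linear (λ j → linear-*ˡ ℓ-linear (α K.^ toℕ j))

  krylov-cong : ∀ {ℓ ℓ′} → (∀ γ → ℓ γ ≡ ℓ′ γ) → ∀ γ → krylov {n} ℓ γ ≡ krylov ℓ′ γ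
  krylov-cong ℓ≗ℓ′ γ = tabulate-cong λ j → ℓ≗ℓ′ (α K.^ toℕ j K.* γ)

  krylov⁻¹ : (K.Carrier → F.Carrier) → Vec F.Carrier n → K.Carrier
  krylov⁻¹ ℓ = preimage (≡-dec F._≟_) (krylov ℓ) K.0# K.elements

  module _ {b₀ : Vec K.Carrier n} (B₀ : Basis b₀) (generates : Generates)
           {ℓ : K.Carrier → F.Carrier} (ℓ-linear : IsLinear ℓ) {ε : K.Carrier} (ℓε≢0 : ℓ ε ≢ F.0#) where

    krylov-kernel : ∀ {δ} → krylov ℓ δ ≡ zeroVec F n → δ ≡ K.0#
    krylov-kernel {δ} krylovδ≡0 with δ K.≟ K.0#
    ... | yes δ≡0 = δ≡0
    ... | no  δ≢0 = ⊥-elim (PowerRelation-below-dimension B₀ λ (m , m≤n , relation) →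
                     let (k , α^kδ≡ε) = generates-transitively generates δ≢0 ε≢0 in
                     ℓε≢0 (begin
                       ℓ ε                ≡⟨ cong ℓ (trans (sym α^kδ≡ε) (K.*-comm _ δ)) ⟩
                       ℓ (δ K.* α K.^ k)  ≡⟨ vanishing-on-powers (linear-*ˡ ℓ-linear δ) relation
                                               (λ j j<m → trans (cong ℓ (K.*-comm δ _)) (low j (NatP.<-≤-trans j<m m≤n))) k ⟩
                       F.0# ∎))
      where
        open ≡-Reasoning
        ε≢0 : ε ≢ K.0#
        ε≢0 ε≡0 = ℓε≢0 (trans (cong ℓ ε≡0) (linear-0 ℓ-linear))
        low : ∀ j → j < n → ℓ (α K.^ j K.* δ) ≡ F.0#
        low j j<n = begin
          ℓ (α K.^ j K.* δ)                           ≡⟨ cong (λ e → ℓ (α K.^ e K.* δ)) (sym (toℕ-fromℕ< j<n)) ⟩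
          ℓ (α K.^ toℕ (fromℕ< j<n) K.* δ)            ≡⟨ sym (lookup∘tabulate _ (fromℕ< j<n)) ⟩
          lookup (krylov ℓ δ) (fromℕ< j<n)            ≡⟨ cong (λ v → lookup v (fromℕ< j<n)) krylovδ≡0 ⟩
          lookup (zeroVec F n) (fromℕ< j<n)           ≡⟨ lookup-replicate (fromℕ< j<n) F.0# ⟩
          F.0# ∎

    krylov-injective : ∀ {γ γ′} → krylov ℓ γ ≡ krylov ℓ γ′ → γ ≡ γ′
    krylov-injective = trivial-kernel⇒injective {φ = krylov ℓ} (krylov-linear ℓ-linear) krylov-kernel

    krylov-krylov⁻¹ : ∀ v → krylov ℓ (krylov⁻¹ ℓ v) ≡ v
    krylov-krylov⁻¹ v =
      let (γ , γ∈ , krylovγ≡v) = injection-onto (≡-dec F._≟_) (krylov ℓ) K.unique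
                                   (λ _ → ∈-allVecsOf F F.elements F.complete _) (λ _ _ → krylov-injective)
                                   (NatP.≤-reflexive (trans (length-allVecsOf F F.elements n) (sym (length-K-elements B₀))))
                                   (∈-allVecsOf F F.elements F.complete v)
      in preimage-correct (≡-dec F._≟_) (krylov ℓ) K.0# γ∈ krylovγ≡v

  module _ {b : Vec K.Carrier n} (B : Basis b) where

    column-M : ∀ k → column F (M α b) k ≡ f_ b (lookup (Vec.map (α K.*_) b) k)
    column-M k = lookup-ext λ i → begin
      lookup (column F (M α b) k) i                 ≡⟨ lookup-column (M α b) i k ⟩
      entry (M α b) i k                             ≡⟨ lookup-tabulate² (λ i k → lookup (f_ b (α K.* lookup b k)) i) i k ⟩
      lookup (f_ b (α K.* lookup b k)) i            ≡⟨ cong (λ γ → lookup (f_ b γ) i) (sym (lookup-map k (α K.*_) b)) ⟩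
      lookup (f_ b (lookup (Vec.map (α K.*_) b) k)) i ∎
      where open ≡-Reasoning

    M-⊛ : ∀ γ → M α b ⊛ f_ b γ ≡ f_ b (α K.* γ)
    M-⊛ γ = begin
      M α b ⊛ f_ b γ                                ≡⟨ ⊛-columns {φ = f_ b} (f-linear B) (M α b) (Vec.map (α K.*_) b)
                                                                  column-M (f_ b γ) ⟩
      f_ b (lincomb (f_ b γ) (Vec.map (α K.*_) b))  ≡⟨ cong (f_ b) (sym (lincomb-map-* α b (f_ b γ))) ⟩
      f_ b (α K.* lincomb (f_ b γ) b)               ≡⟨ cong (λ γ′ → f_ b (α K.* γ′)) (Basis.lincomb-f B γ) ⟩
      f_ b (α K.* γ) ∎
      where open ≡-Reasoning

    M^-⊛ : ∀ j γ → (M α b ^ j) ⊛ f_ b γ ≡ f_ b (α K.^ j K.* γ)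
    M^-⊛ zero    γ = trans (identity-⊛ (f_ b γ)) (cong (f_ b) (sym (K.*-identityˡ γ)))
    M^-⊛ (suc j) γ = begin
      _·_ F (M α b ^ j) (M α b) ⊛ f_ b γ            ≡⟨ ·-⊛ (M α b ^ j) (M α b) (f_ b γ) ⟩
      (M α b ^ j) ⊛ M α b ⊛ f_ b γ                  ≡⟨ cong ((M α b ^ j) ⊛_) (M-⊛ γ) ⟩
      (M α b ^ j) ⊛ f_ b (α K.* γ)                  ≡⟨ M^-⊛ j (α K.* γ) ⟩
      f_ b (α K.^ j K.* (α K.* γ))                  ≡⟨ cong (f_ b) (K.x∙yz≈yx∙z (α K.^ j) α γ) ⟩
      f_ b (α K.^ suc j K.* γ) ∎
      where open ≡-Reasoning

    column-D : ∀ x k → column F (D α b x) k ≡ krylov (functional b x) (lookup b k)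
    column-D x k = lookup-ext λ j → begin
      lookup (column F (D α b x) k) j                           ≡⟨ lookup-column (D α b x) j k ⟩
      entry (D α b x) j k                                       ≡⟨ lookup-tabulate² (λ j k → dot F x (column F (M α b ^ toℕ j) k)) j k ⟩
      dot F x (column F (M α b ^ toℕ j) k)                      ≡⟨ cong (dot F x) (sym (⊛-unit (M α b ^ toℕ j) k)) ⟩
      dot F x ((M α b ^ toℕ j) ⊛ unit k)                        ≡⟨ cong (λ v → dot F x ((M α b ^ toℕ j) ⊛ v)) (sym (f-lookup B k)) ⟩
      dot F x ((M α b ^ toℕ j) ⊛ f_ b (lookup b k))             ≡⟨ cong (dot F x) (M^-⊛ (toℕ j) (lookup b k)) ⟩
      functional b x (α K.^ toℕ j K.* lookup b k)               ≡⟨ sym (lookup∘tabulate _ j) ⟩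
      lookup (krylov (functional b x) (lookup b k)) j ∎
      where open ≡-Reasoning

module Fibre (F K : FiniteField) (h : FieldHom F K) (α : FiniteField.Carrier K) where
  open ExtensionProperties F K h
  open Krylov F K h α
  open Extension F K h using (lincomb; f_; D; isBasis; allBases; sampleSpace; fiberCount)
  open LinearAlgebra F
  open ListCounting
  open VectorEnumeration
  open Equivalence using (to; from)

  nonzero : ∀ {n} → Vec F.Carrier n → Bool
  nonzero {n} x = not (vecEq F x (zeroVec F n))

  T-nonzero : ∀ {n} {x : Vec F.Carrier n} → T (nonzero x) ⇔ (x ≢ zeroVec F n)
  T-nonzero {n} {x} = T-not-does (≡-dec F._≟_ x (zeroVec F n))

  ∈-sampleSpace : ∀ {n b x} → (b , x) ∈ sampleSpace n ⇔ (T (isBasis b) × x ≢ zeroVec F n)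
  ∈-sampleSpace {n} {b} {x} = mk⇔
    (Product.map₂ (to T-nonzero) ∘ to T-∧ ∘ proj₂ ∘ ∈-filterᵇ⁻ _ (cartesianProduct (allVecs K n) (allVecs F n)))
    (∈-filterᵇ⁺ _ (∈-cartesianProduct⁺ (∈-allVecsOf K K.elements K.complete b) (∈-allVecsOf F F.elements F.complete x))
      ∘ from T-∧ ∘ Product.map₂ (from T-nonzero))

  module _ {n} {b₀ : Vec K.Carrier n} (B₀ : Basis b₀) (generates : Generates)
           {A E : Matrix F n} (E-inverse : E IsInverseOf A) where

    inFibre : Vec K.Carrier n × Vec F.Carrier n → Bool
    inFibre (b , x) = isInverseOf F A (D α b x)

    fibre : List (Vec K.Carrier n × Vec F.Carrier n)
    fibre = filterᵇ inFibre (sampleSpace n)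

    T-inFibre : ∀ {b x} → T (inFibre (b , x)) ⇔ D α b x ≡ E
    T-inFibre {b} {x} = mk⇔
      (λ A⁻¹ → inverse-unique {A = A} {X = D α b x} {Y = E}
                 (proj₁ (to (T-isInverseOf {A = D α b x} {B = A}) A⁻¹)) (proj₁ E-inverse))
      (λ D≡E → from (T-isInverseOf {A = D α b x} {B = A})
                 (subst (λ Z → A IsInverseOf Z) (sym D≡E) (Product.swap E-inverse)))

    D≡E⇔krylov : ∀ {b} → Basis b → ∀ x →
                 D α b x ≡ E ⇔ (∀ k → krylov (functional b x) (lookup b k) ≡ column F E k)
    D≡E⇔krylov {b} B x = mk⇔
      (λ D≡E k → trans (sym (column-D B x k)) (cong (λ Z → column F Z k) D≡E))
      (λ krylov≡ → column-ext λ k → trans (column-D B x k) (krylov≡ k))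

    ∈-fibre : ∀ {b x} → (b , x) ∈ fibre ⇔ ((T (isBasis b) × x ≢ zeroVec F n) × D α b x ≡ E)
    ∈-fibre {b} {x} = mk⇔
      (Product.map (to ∈-sampleSpace) (to (T-inFibre {b} {x})) ∘ ∈-filterᵇ⁻ inFibre (sampleSpace n))
      (λ (in-sample , D≡E) → ∈-filterᵇ⁺ inFibre (from ∈-sampleSpace in-sample) (from (T-inFibre {b} {x}) D≡E))

    coefficients : Vec K.Carrier n × Vec F.Carrier n → Vec F.Carrier n
    coefficients (b , x) = Vec.map (functional b x) b₀

    basisFor : Vec F.Carrier n → Vec K.Carrier n
    basisFor y = tabulate λ k → krylov⁻¹ (functional b₀ y) (column F E k)

    vectorFor : Vec F.Carrier n → Vec F.Carrier n
    vectorFor y = Vec.map (functional b₀ y) (basisFor y)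

    module _ {y : Vec F.Carrier n} (y≢0 : y ≢ zeroVec F n) where

      krylov-basisFor : ∀ k → krylov (functional b₀ y) (lookup (basisFor y) k) ≡ column F E k
      krylov-basisFor k =
        let (ε , ℓε≢0) = nonzero-functional B₀ y≢0 in
        trans (cong (krylov (functional b₀ y)) (lookup∘tabulate _ k))
              (krylov-krylov⁻¹ B₀ generates (functional-linear B₀ y) ℓε≢0 (column F E k))

      krylov-functional-injective : ∀ {γ γ′} → krylov (functional b₀ y) γ ≡ krylov (functional b₀ y) γ′ → γ ≡ γ′
      krylov-functional-injective =
        krylov-injective B₀ generates (functional-linear B₀ y) (proj₂ (nonzero-functional B₀ y≢0))

      basisFor-isBasis : T (isBasis (basisFor y))
      basisFor-isBasis = columns-invertible⇒isBasis {φ = krylov (functional b₀ y)}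
        (krylov-linear (functional-linear B₀ y)) krylov-functional-injective (Product.swap E-inverse) (basisFor y) krylov-basisFor

      basisFor-basis : Basis (basisFor y)
      basisFor-basis = isBasis⇒Basis basisFor-isBasis

      functional-basisFor : ∀ γ → functional (basisFor y) (vectorFor y) γ ≡ functional b₀ y γ
      functional-basisFor = functional-map basisFor-basis (functional-linear B₀ y)

      vectorFor-nonzero : vectorFor y ≢ zeroVec F n
      vectorFor-nonzero vectorFor≡0 =
        let (ε , ℓε≢0) = nonzero-functional B₀ y≢0 in
        ℓε≢0 (begin
          functional b₀ y ε                         ≡⟨ sym (functional-basisFor ε) ⟩
          functional (basisFor y) (vectorFor y) ε   ≡⟨ cong (λ x → functional (basisFor y) x ε) vectorFor≡0 ⟩
          functional (basisFor y) (zeroVec F n) ε   ≡⟨ dot-zeroˡ (f_ (basisFor y) ε) ⟩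
          F.0# ∎)
        where open ≡-Reasoning

      basisFor-∈-fibre : (basisFor y , vectorFor y) ∈ fibre
      basisFor-∈-fibre = from ∈-fibre
        ( (basisFor-isBasis , vectorFor-nonzero)
        , from (D≡E⇔krylov basisFor-basis (vectorFor y))
            (λ k → trans (krylov-cong functional-basisFor (lookup (basisFor y) k)) (krylov-basisFor k)))

      coefficients-basisFor : coefficients (basisFor y , vectorFor y) ≡ y
      coefficients-basisFor = lookup-ext λ k → begin
        lookup (coefficients (basisFor y , vectorFor y)) k        ≡⟨ lookup-map k _ b₀ ⟩
        functional (basisFor y) (vectorFor y) (lookup b₀ k)       ≡⟨ functional-basisFor (lookup b₀ k) ⟩
        functional b₀ y (lookup b₀ k)                             ≡⟨ functional-lookup B₀ y k ⟩
        lookup y k ∎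
        where open ≡-Reasoning

    coefficients-nonzero : ∀ {b x} → Basis b → x ≢ zeroVec F n → coefficients (b , x) ≢ zeroVec F n
    coefficients-nonzero {b} {x} B x≢0 y≡0 = x≢0 (lookup-ext λ k → begin
      lookup x k                                              ≡⟨ sym (functional-lookup B x k) ⟩
      functional b x (lookup b k)                             ≡⟨ sym (functional-map B₀ (functional-linear B x) (lookup b k)) ⟩
      functional b₀ (coefficients (b , x)) (lookup b k)       ≡⟨ cong (λ y → functional b₀ y (lookup b k)) y≡0 ⟩
      functional b₀ (zeroVec F n) (lookup b k)                ≡⟨ dot-zeroˡ (f_ b₀ (lookup b k)) ⟩
      F.0#                                                    ≡⟨ sym (lookup-replicate k F.0#) ⟩
      lookup (zeroVec F n) k ∎)
      where open ≡-Reasoning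

    module _ {b x} (bx∈fibre : (b , x) ∈ fibre) where
      private
        B : Basis b
        B = isBasis⇒Basis (proj₁ (proj₁ (to ∈-fibre bx∈fibre)))

        y≢0 : coefficients (b , x) ≢ zeroVec F n
        y≢0 = coefficients-nonzero B (proj₂ (proj₁ (to ∈-fibre bx∈fibre)))

        same-functional : ∀ γ → functional b₀ (coefficients (b , x)) γ ≡ functional b x γ
        same-functional = functional-map B₀ (functional-linear B x)

      coefficients-∈ : coefficients (b , x) ∈ filterᵇ nonzero (allVecs F n)
      coefficients-∈ = ∈-filterᵇ⁺ nonzero (∈-allVecsOf F F.elements F.complete _) (from T-nonzero y≢0)

      basisFor-coefficients : basisFor (coefficients (b , x)) ≡ b
      basisFor-coefficients = lookup-ext λ k → krylov-functional-injective y≢0 (begin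
        krylov (functional b₀ y) (lookup (basisFor y) k)   ≡⟨ krylov-basisFor y≢0 k ⟩
        column F E k                                       ≡⟨ sym (to (D≡E⇔krylov B x) (proj₂ (to ∈-fibre bx∈fibre)) k) ⟩
        krylov (functional b x) (lookup b k)               ≡⟨ sym (krylov-cong same-functional (lookup b k)) ⟩
        krylov (functional b₀ y) (lookup b k) ∎)
        where
          open ≡-Reasoning
          y : Vec F.Carrier n
          y = coefficients (b , x)

      vectorFor-coefficients : vectorFor (coefficients (b , x)) ≡ x
      vectorFor-coefficients = lookup-ext λ k → begin
        lookup (vectorFor y) k                    ≡⟨ lookup-map k (functional b₀ y) (basisFor y) ⟩
        functional b₀ y (lookup (basisFor y) k)   ≡⟨ cong (λ b′ → functional b₀ y (lookup b′ k)) basisFor-coefficients ⟩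
        functional b₀ y (lookup b k)              ≡⟨ same-functional (lookup b k) ⟩
        functional b x (lookup b k)               ≡⟨ functional-lookup B x k ⟩
        lookup x k ∎
        where
          open ≡-Reasoning
          y : Vec F.Carrier n
          y = coefficients (b , x)

    fibre≃nonzero : ListBijection fibre (filterᵇ nonzero (allVecs F n))
    fibre≃nonzero = record
      { to      = coefficients
      ; from    = λ y → basisFor y , vectorFor y
      ; to-∈    = λ {p} → coefficients-∈ {proj₁ p} {proj₂ p}
      ; from-∈  = basisFor-∈-fibre ∘ nonzero-∈
      ; from∘to = λ {p} p∈ → cong₂ _,_ (basisFor-coefficients {proj₁ p} {proj₂ p} p∈) (vectorFor-coefficients p∈)
      ; to∘from = coefficients-basisFor ∘ nonzero-∈
      }
      where
        nonzero-∈ : ∀ {y} → y ∈ filterᵇ nonzero (allVecs F n) → y ≢ zeroVec F n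
        nonzero-∈ = to T-nonzero ∘ proj₂ ∘ ∈-filterᵇ⁻ nonzero (allVecs F n)

    fiberCount≡length-nonzero : fiberCount α n A ≡ length (filterᵇ nonzero (allVecs F n))
    fiberCount≡length-nonzero = length-bijection (≡-dec-× (≡-dec K._≟_) (≡-dec F._≟_)) (≡-dec F._≟_)
      (filterᵇ-unique (filterᵇ-unique
        (cartesianProduct⁺ (allVecsOf-unique K K.elements K.unique n) (allVecsOf-unique F F.elements F.unique n))))
      (filterᵇ-unique (allVecsOf-unique F F.elements F.unique n))
      fibre≃nonzero

open Nat using (_*_)

mainTheorem4 : (F K : FiniteField) (h : FieldHom F K) (n : ℕ) → 1 ≤ n
    → Extension.HasDegree F K h n
    → (α : FiniteField.Carrier K) → Extension.IsGenerator F K h α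
    → (A : Matrix F n) → T (isInvertible F A)
    → Extension.fiberCount F K h α n A * GLcount F n ≡ length (Extension.sampleSpace F K h n)
mainTheorem4 F K h n _ (b₀ , b₀-isBasis) α generator A A-invertible = begin
  fiberCount α n A * GLcount F n
    ≡⟨ cong₂ _*_ (fiberCount≡length-nonzero B₀ (IsGenerator⇒Generates generator) (proj₂ A⁻¹))
                 (GLcount≡length-allBases B₀) ⟩
  length (filterᵇ nonzero (allVecs F n)) * length (allBases n)
    ≡⟨ NatP.*-comm (length (filterᵇ nonzero (allVecs F n))) (length (allBases n)) ⟩
  length (allBases n) * length (filterᵇ nonzero (allVecs F n))
    ≡⟨ sym (ListCounting.length-filterᵇ-cartesianProduct isBasis nonzero (allVecs K n) (allVecs F n)) ⟩
  length (sampleSpace n) ∎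
  where
    open ≡-Reasoning
    open Extension F K h using (fiberCount; isBasis; allBases; sampleSpace)
    open LinearAlgebra F using (T-isInvertible; _IsInverseOf_)
    open ExtensionProperties F K h using (Basis; isBasis⇒Basis; GLcount≡length-allBases)
    open Krylov F K h α using (IsGenerator⇒Generates)
    open Fibre F K h α using (nonzero; fiberCount≡length-nonzero)
    B₀ : Basis b₀
    B₀ = isBasis⇒Basis b₀-isBasis
    A⁻¹ : ∃ λ E → E IsInverseOf A
    A⁻¹ = Equivalence.to T-isInvertible A-invertible
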